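{- Let $r\ge 3$ and let $G$ be a graph with $\chi(G)=k=r$. For a fixed $n$, consider quadruples $(W,X,Y,Z)$ where $W\subseteq V(G)$ is an independent set, $X,Y\subseteq E(G)$ are disjoint sets of edges none of which is incident to $W$, the graph obtained from $G$ by deleting the vertices of $W$ and the edges of $X$ has chromatic number $k-1$, the graph obtained from $G$ by deleting the vertices of $W$ and the edges of $X\cup Y$ has chromatic number $k-2$, and $Z$ is the set of edges of $G$ not incident to $W$ and not in $X\cup Y$. Let $$f(W,X,Y,Z)=|X|\binom{n}{r-1}+|Y|\binom{k-1}{r-1}\left(\frac{n}{k-1}\right)^{r-1}+(|W|+|Z|-1)\binom{k-2}{r-1}\left(\frac{n}{k-2}\right)^{r-1},$$ let $(W,X,Y,Z)$ be such a quadruple minimizing $f$ (the minimum value being $h(G)$), and let $w,x,y,z$ be the sizes of $W,X,Y,Z$. Let $\mathcal{G}_1'$ be the $n$-vertex $r$-graph defined as follows: its vertex set is the disjoint union of sets $A,B,C,D$ with $|A|=w+z-1$, $|B|=x$, $|C|=y$, $|D|=n-w-x-y-z+1$; on $D$ take a complete $(k-2)$-partite $(r-1)$-graph $\mathcal{G}_0$ and a complete $(k-1)$-partite $(r-1)$-graph $\mathcal{G}_0'$; the hyperedges of $\mathcal{G}_1'$ are the $r$-sets consisting of a vertex of $B$ and $r-1$ vertices of $D$, the $r$-sets consisting of a vertex of $A$ and a hyperedge of $\mathcal{G}_0$, and the $r$-sets consisting of a vertex of $C$ and a hyperedge of $\mathcal{G}_0'$. Then $\mathcal{G}_1'$ does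 not contain $G^r$ as a subhypergraph.
   Context: For a graph $G$, its $r$-expansion $G^r$ is the $r$-graph obtained from $G$ by adding $r-2$ new vertices to each edge of $G$, all these $(r-2)|E(G)|$ new vertices being distinct from each other and from $V(G)$. A complete $\ell$-partite $(r-1)$-graph on a set $D$ (with respect to a partition of $D$ into $\ell$ parts) has as hyperedges all $(r-1)$-subsets of $D$ meeting each part in at most one vertex. -}

module Defs where

open import Data.Nat as ℕ using (ℕ; zero; suc; _≤_; _<_; _∸_; _<?_)
open import Data.Nat.Combinatorics using (_C_)
open import Data.Integer as ℤ using (+_)
open import Data.Rational as ℚ using (ℚ)
open import Data.Fin as Fin using (Fin; toℕ)
open import Data.Fin.Subset using (Subset; _∈_; _∉_; ∣_∣)
open import Data.Fin.Properties using (any?)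
open import Data.Bool using (Bool; true; false; not; _∧_; _∨_)
open import Data.Vec using (tabulate)
import Data.Vec as Vec
open import Data.List using (List; length; lookup)
open import Data.List.Relation.Unary.All using (All)
open import Data.List.Relation.Unary.Unique.Propositional using (Unique)
open import Data.Product using (Σ; _×_; _,_; proj₁; proj₂)
open import Data.Sum using (_⊎_; inj₁; inj₂)
open import Data.Unit using (⊤)
open import Relation.Nullary using (¬_; does)
open import Relation.Binary.PropositionalEquality using (_≡_; _≢_)
open import Function.Definitions using (Injective)

-- Finite simple graphs: vertex set Fin m, edge set a duplicate-free list
-- of pairs (u , v) with u < v (so each unordered edge occurs once).

record Graph : Set where
  field
    m       : ℕ
    edges   : List (Fin m × Fin m)
    ordered : All (λ e → proj₁ e Fin.< proj₂ e) edges
    unique  : Unique edges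

open Graph public

-- indices of edges; a set of edges is a Subset of these indices
EIdx : Graph → Set
EIdx G = Fin (length (edges G))

src tgt : (G : Graph) → EIdx G → Fin (m G)
src G i = proj₁ (lookup (edges G) i)
tgt G i = proj₂ (lookup (edges G) i)

Incident : (G : Graph) → Subset (m G) → EIdx G → Set
Incident G W i = (src G i ∈ W) ⊎ (tgt G i ∈ W)

incident? : (G : Graph) → Subset (m G) → EIdx G → Bool
incident? G W i = Vec.lookup W (src G i) ∨ Vec.lookup W (tgt G i)

IndependentSet : (G : Graph) → Subset (m G) → Set
IndependentSet G W = (i : EIdx G) → ¬ ((src G i ∈ W) × (tgt G i ∈ W))

-- The subgraph of G with vertex set V(G) ∖ W and edge set {i | P i}
-- (P only ever selects edges not incident to W).  Proper c-colourings
-- and chromatic number of that subgraph.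

Colourable : (G : Graph) → Subset (m G) → (EIdx G → Set) → ℕ → Set
Colourable G W P c =
  Σ ((v : Fin (m G)) → v ∉ W → Fin c) λ col →
    (i : EIdx G) → P i → (pu : src G i ∉ W) (pv : tgt G i ∉ W) →
      col (src G i) pu ≢ col (tgt G i) pv

HasChromaticNumber : (G : Graph) → Subset (m G) → (EIdx G → Set) → ℕ → Set
HasChromaticNumber G W P c =
  Colourable G W P c × ((c′ : ℕ) → c′ < c → ¬ Colourable G W P c′)

χ≡ : Graph → ℕ → Set
χ≡ G k = HasChromaticNumber G Data.Fin.Subset.⊥ (λ _ → ⊤) k

KeepWX : (G : Graph) → Subset (m G) → Subset (length (edges G)) → EIdx G → Set
KeepWX G W X i = (¬ Incident G W i) × (i ∉ X)

KeepWXY : (G : Graph) → Subset (m G) → (X Y : Subset (length (edges G))) → EIdx G → Set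
KeepWXY G W X Y i = (¬ Incident G W i) × (i ∉ X) × (i ∉ Y)

-- admissible (W , X , Y) for χ(G) = k (Z is then determined)
Admissible : (G : Graph) → ℕ → Subset (m G) → (X Y : Subset (length (edges G))) → Set
Admissible G k W X Y =
    IndependentSet G W
  × ((i : EIdx G) → ¬ ((i ∈ X) × (i ∈ Y)))
  × ((i : EIdx G) → i ∈ X → ¬ Incident G W i)
  × ((i : EIdx G) → i ∈ Y → ¬ Incident G W i)
  × HasChromaticNumber G W (KeepWX G W X) (k ∸ 1)
  × HasChromaticNumber G W (KeepWXY G W X Y) (k ∸ 2)

Zset : (G : Graph) → Subset (m G) → (X Y : Subset (length (edges G))) → Subset (length (edges G))
Zset G W X Y = tabulate λ i →
  not (incident? G W i) ∧ not (Vec.lookup X i) ∧ not (Vec.lookup Y i)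

ℕ→ℚ : ℕ → ℚ
ℕ→ℚ a = (+ a) ℚ./ 1

_^ℚ_ : ℚ → ℕ → ℚ
q ^ℚ zero  = ℚ.1ℚ
q ^ℚ suc e = q ℚ.* (q ^ℚ e)

-- a / d as a rational; only used with d ≥ 1 (value at d = 0 is junk 0)
frac : ℕ → ℕ → ℚ
frac a zero    = ℚ.0ℚ
frac a (suc d) = (+ a) ℚ./ suc d

fval : (n r k w x y z : ℕ) → ℚ
fval n r k w x y z =
  ((ℕ→ℚ x ℚ.* ℕ→ℚ (n C (r ∸ 1)))
   ℚ.+ (ℕ→ℚ y ℚ.* ℕ→ℚ ((k ∸ 1) C (r ∸ 1)) ℚ.* (frac n (k ∸ 1) ^ℚ (r ∸ 1))))
   ℚ.+ ((ℕ→ℚ (w ℕ.+ z) ℚ.- ℚ.1ℚ) ℚ.* ℕ→ℚ ((k ∸ 2) C (r ∸ 1)) ℚ.* (frac n (k ∸ 2) ^ℚ (r ∸ 1)))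

f : (G : Graph) → (n r k : ℕ) → Subset (m G) → (X Y : Subset (length (edges G))) → ℚ
f G n r k W X Y = fval n r k (∣ W ∣) (∣ X ∣) (∣ Y ∣) (∣ Zset G W X Y ∣)

IsMinimiser : (G : Graph) → (n r k : ℕ) → Subset (m G) → (X Y : Subset (length (edges G))) → Set
IsMinimiser G n r k W X Y =
  Admissible G k W X Y ×
  ((W′ : Subset (m G)) (X′ Y′ : Subset (length (edges G))) →
     Admissible G k W′ X′ Y′ → f G n r k W X Y ℚ.≤ f G n r k W′ X′ Y′)

Hypergraph : ℕ → Set₁
Hypergraph n = Subset n → Set

image : {t n : ℕ} → (Fin t → Fin n) → Subset n
image g = tabulate λ y → does (any? λ i → g i Fin.≟ y)

-- r-expansion G^r: vertices V(G) plus r-2 new vertices per edge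
ExpV : Graph → ℕ → Set
ExpV G r = Fin (m G) ⊎ (EIdx G × Fin (r ∸ 2))

expEdge : (G : Graph) (r : ℕ) → EIdx G → Fin (suc (suc (r ∸ 2))) → ExpV G r
expEdge G r i Fin.zero             = inj₁ (src G i)
expEdge G r i (Fin.suc Fin.zero)   = inj₁ (tgt G i)
expEdge G r i (Fin.suc (Fin.suc j)) = inj₂ (i , j)

-- H contains G^r as a (not necessarily induced) subhypergraph
ContainsExpansion : {n : ℕ} → Hypergraph n → Graph → ℕ → Set
ContainsExpansion {n} H G r =
  Σ (ExpV G r → Fin n) λ φ →
    Injective _≡_ _≡_ φ × ((i : EIdx G) → H (image (λ j → φ (expEdge G r i j))))

-- the r-graph G₁′ on Fin n = A ⊔ B ⊔ C ⊔ D, |A| = a, |B| = b, |C| = c,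
-- D = the remaining vertices (listed in this order)

data Region : Set where
  RA RB RC RD : Region

region : {n : ℕ} (a b c : ℕ) → Fin n → Region
region a b c v with toℕ v <? a
... | Relation.Nullary.yes _ = RA
... | Relation.Nullary.no _ with toℕ v <? a ℕ.+ b
...   | Relation.Nullary.yes _ = RB
...   | Relation.Nullary.no _ with toℕ v <? a ℕ.+ b ℕ.+ c
...     | Relation.Nullary.yes _ = RC
...     | Relation.Nullary.no _ = RD

-- e consists of one vertex u in region R and r-1 vertices of D forming a
-- hyperedge of the complete partite (r-1)-graph on D given by part : Fin n → Fin ℓ
-- (the r-1 count is ensured by |e| = r)
OneInPlusPartite : {n ℓ : ℕ} (a b c : ℕ) → Region → (Fin n → Fin ℓ) → Subset n → Set
OneInPlusPartite {n} a b c R part e =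
  Σ (Fin n) λ u → (u ∈ e) × (region a b c u ≡ R)
    × ((v : Fin n) → v ∈ e → v ≢ u → region a b c v ≡ RD)
    × ((v v′ : Fin n) → v ∈ e → v′ ∈ e → v ≢ u → v′ ≢ u → v ≢ v′ → part v ≢ part v′)

OneInPlusD : {n : ℕ} (a b c : ℕ) → Region → Subset n → Set
OneInPlusD {n} a b c R e =
  Σ (Fin n) λ u → (u ∈ e) × (region a b c u ≡ R)
    × ((v : Fin n) → v ∈ e → v ≢ u → region a b c v ≡ RD)

-- G₁′: p₀ is the (k-2)-partition of D (for 𝒢₀), p₁ the (k-1)-partition (for 𝒢₀′);
-- their values outside D are irrelevant.
G₁′ : (n r k a b c : ℕ) → (Fin n → Fin (k ∸ 2)) → (Fin n → Fin (k ∸ 1)) → Hypergraph n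
G₁′ n r k a b c p₀ p₁ e =
  (∣ e ∣ ≡ r) ×
  (OneInPlusD a b c RB e
   ⊎ OneInPlusPartite a b c RA p₀ e
   ⊎ OneInPlusPartite a b c RC p₁ e)

{-# OPTIONS --safe #-}
-- For k = r the last term of f vanishes and f = |X|·C(n,r-1) + |Y|·(n/(r-1))^(r-1), where the
-- first coefficient is the larger one.  Hyperedges of G₁′ through A would need r - 1 vertices
-- in distinct parts of a (r-2)-partition, so an embedding φ of G^r sends every edge of G to a
-- hyperedge with an apex in B or C and its other r - 1 vertices in D.  The vertices of G sent
-- outside D form an independent set W (both ends of an edge would be its apex); an edge of G - W
-- has one of its subdivision vertices as apex, so these apexes are distinct, and (after adding a
-- vertex to W if needed) some point of B ∪ C is no apex at all.  Hence the edges of G - W with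
-- apex in B, resp. C, form sets X₀, Y₀ with |X₀| ≤ |X|, |Y₀| ≤ |Y|, one of them strict.
-- Colouring through the (r-1)-partition of D gives χ(G - W - X₀) ≤ r - 1 ≤ χ(G - W).  Putting
-- the edges of X₀ back one at a time yields X′ ⊆ X₀ with χ(G - W - X′) = r - 1; as
-- G - W - X′ - (Y₀ ∪ (X₀ ∖ X′)) has no edges, the same process yields Y′ ⊆ Y₀ ∪ (X₀ ∖ X′) with
-- χ(G - W - X′ - Y′) = r - 2.  Then (W, X′, Y′) is admissible with smaller f.
module Submission where

open import Algebra.Bundles using (CommutativeMonoid)
import Algebra.Properties.CommutativeSemigroup as CommSemigroupProperties
import Data.Integer as ℤ
import Data.Integer.Properties as ℤP
open import Data.Fin as Fin using (Fin; zero; suc; toℕ; punchIn; punchOut)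
open import Data.Fin.Properties
  using ( any?; ¬Fin0; suc-injective; toℕ-injective; toℕ-fromℕ<; toℕ<n; injective⇒≤
        ; punchIn-injective; punchInᵢ≢i; punchOut-injective; inject≤-injective; inject₁-injective
        ; fromℕ≢inject₁)
open import Data.Fin.Subset as Sub using (Subset; _∈_; _∉_; _⊆_; _∩_; _∪_; _─_; ∣_∣; ⁅_⁆; inside; outside)
open import Data.Fin.Subset.Properties
  using ( _∈?_; drop-∷-⊆; x∈p∩q⁻; x∈p∩q⁺; p∩q⊆p; p⊆p∪q; q⊆p∪q; x∈p∪q⁻; x∈⁅x⁆; x∈⁅y⁆⇒x≡y
        ; x∈p∧x∉q⇒x∈p─q; p─q⊆p; p⊆q⇒∣p∣≤∣q∣)
open import Data.List using (length)
import Data.List.Relation.Unary.All as All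
open import Data.List.Membership.Propositional.Properties using (∈-lookup)
open import Data.Nat as ℕ using (ℕ; zero; suc; _+_; _*_; _^_; _∸_; _≤_; _<_; z≤n; s≤s)
open import Data.Nat.Combinatorics using (_C_; nCn≡1; nC1≡n; k>n⇒nCk≡0; nCk+nC[k+1]≡[n+1]C[k+1])
import Data.Nat.Coprimality as Coprimality
open import Data.Nat.Properties as ℕP using (≤-refl; ≤-trans; +-suc)
open import Data.Product using (Σ; ∃; _×_; _,_; proj₁; proj₂)
open import Data.Product.Properties using (,-injectiveˡ; ,-injectiveʳ)
open import Data.Rational as ℚ using (ℚ; mkℚ; 0ℚ; 1ℚ; Positive; NonNegative)
import Data.Rational.Properties as ℚP
open import Data.Rational.Unnormalised as ℚᵘ using (mkℚᵘ)
import Data.Rational.Unnormalised.Properties as ℚᵘP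
open import Data.Sum as Sum using (_⊎_; inj₁; inj₂; [_,_]′)
open import Data.Sum.Properties using (inj₁-injective; inj₂-injective)
open import Data.Unit using (⊤)
open import Data.Vec using ([]; _∷_; tabulate; here; there)
open import Function using (_∘_; id; case_of_)
open import Function.Definitions using (Injective)
open import Level using (Level)
open import Relation.Binary.PropositionalEquality
  using (_≡_; _≢_; refl; sym; trans; cong; cong₂; subst; subst₂; module ≡-Reasoning)
open import Relation.Nullary
  using (¬_; Dec; yes; no; does; contradiction; ¬¬-excluded-middle; ¬?; _×-dec_; _⊎-dec_)
open import Relation.Nullary.Negation using (¬¬-map)
open import Relation.Unary using (Pred; Decidable)

open import Defs
  using ( Graph; m; edges; ordered; EIdx; src; tgt; Incident; IndependentSet; Colourable
        ; HasChromaticNumber; χ≡; KeepWX; Admissible; Zset; IsMinimiser; ℕ→ℚ; _^ℚ_; frac; fval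
        ; image; ExpV; expEdge; ContainsExpansion; Region; RA; RB; RC; RD; region
        ; OneInPlusD; OneInPlusPartite; G₁′)

private
  variable
    ℓ : Level
    n w : ℕ

-- Counting in subsets of Fin n

select : {P : Pred (Fin n) ℓ} → Decidable P → Subset n
select P? = tabulate (λ x → does (P? x))

∈select⁺ : {P : Pred (Fin n) ℓ} (P? : Decidable P) {x : Fin n} → P x → x ∈ select P?
∈select⁺ P? {zero} px with P? zero
... | yes _   = here
... | no ¬px  = contradiction px ¬px
∈select⁺ P? {suc x} px = there (∈select⁺ (λ y → P? (suc y)) px)

∈select⁻ : {P : Pred (Fin n) ℓ} (P? : Decidable P) {x : Fin n} → x ∈ select P? → P x
∈select⁻ P? {zero} x∈ with P? zero | x∈
... | yes px | here = px
∈select⁻ P? {suc x} (there x∈) = ∈select⁻ (λ y → P? (suc y)) x∈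

∈image⁺ : ∀ {t} (g : Fin t → Fin n) j → g j ∈ image g
∈image⁺ g j = ∈select⁺ (λ y → any? λ i → g i Fin.≟ y) (j , refl)

∈image⁻ : ∀ {t} (g : Fin t → Fin n) {y} → y ∈ image g → ∃ λ j → g j ≡ y
∈image⁻ g = ∈select⁻ (λ y → any? λ i → g i Fin.≟ y)

∣p∪q∣≤∣p∣+∣q∣ : (p q : Subset n) → ∣ p ∪ q ∣ ≤ ∣ p ∣ + ∣ q ∣
∣p∪q∣≤∣p∣+∣q∣ []            []            = z≤n
∣p∪q∣≤∣p∣+∣q∣ (inside  ∷ p) (inside  ∷ q) = s≤s (≤-trans (∣p∪q∣≤∣p∣+∣q∣ p q) (ℕP.+-monoʳ-≤ ∣ p ∣ (ℕP.n≤1+n _)))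
∣p∪q∣≤∣p∣+∣q∣ (inside  ∷ p) (outside ∷ q) = s≤s (∣p∪q∣≤∣p∣+∣q∣ p q)
∣p∪q∣≤∣p∣+∣q∣ (outside ∷ p) (inside  ∷ q) =
  ≤-trans (s≤s (∣p∪q∣≤∣p∣+∣q∣ p q)) (ℕP.≤-reflexive (sym (+-suc ∣ p ∣ ∣ q ∣)))
∣p∪q∣≤∣p∣+∣q∣ (outside ∷ p) (outside ∷ q) = ∣p∪q∣≤∣p∣+∣q∣ p q

q⊆p⇒∣q∣+∣p─q∣≡∣p∣ : ∀ {p q : Subset n} → q ⊆ p → ∣ q ∣ + ∣ p ─ q ∣ ≡ ∣ p ∣
q⊆p⇒∣q∣+∣p─q∣≡∣p∣ {p = []}          {[]}          _   = refl
q⊆p⇒∣q∣+∣p─q∣≡∣p∣ {p = inside  ∷ p} {inside  ∷ q} q⊆p = cong suc (q⊆p⇒∣q∣+∣p─q∣≡∣p∣ (drop-∷-⊆ q⊆p))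
q⊆p⇒∣q∣+∣p─q∣≡∣p∣ {p = inside  ∷ p} {outside ∷ q} q⊆p =
  trans (+-suc ∣ q ∣ ∣ p ─ q ∣) (cong suc (q⊆p⇒∣q∣+∣p─q∣≡∣p∣ (drop-∷-⊆ q⊆p)))
q⊆p⇒∣q∣+∣p─q∣≡∣p∣ {p = outside ∷ p} {inside  ∷ q} q⊆p with () ← q⊆p here
q⊆p⇒∣q∣+∣p─q∣≡∣p∣ {p = outside ∷ p} {outside ∷ q} q⊆p = q⊆p⇒∣q∣+∣p─q∣≡∣p∣ (drop-∷-⊆ q⊆p)

x∈p─q⇒x∉q : ∀ {x} (p q : Subset n) → x ∈ p ─ q → x ∉ q
x∈p─q⇒x∉q (inside ∷ p) (outside ∷ q) here       ()
x∈p─q⇒x∉q (_      ∷ p) (_       ∷ q) (there x∈) (there x∈q) = x∈p─q⇒x∉q p q x∈ x∈q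

∣p∣≤-injection : (p : Subset n) (e : ∀ x → x ∈ p → Fin w) →
                 (∀ {x y} x∈p y∈p → e x x∈p ≡ e y y∈p → x ≡ y) → ∣ p ∣ ≤ w
∣p∣≤-injection []            e e-inj = z≤n
∣p∣≤-injection (outside ∷ p) e e-inj =
  ∣p∣≤-injection p (λ x x∈p → e (suc x) (there x∈p)) (λ x∈p y∈p eq → suc-injective (e-inj (there x∈p) (there y∈p) eq))
∣p∣≤-injection {w = zero}  (inside ∷ p) e e-inj with () ← e zero here
∣p∣≤-injection {w = suc w} (inside ∷ p) e e-inj = s≤s (∣p∣≤-injection p e′ e′-inj)
  where
  e₀≢ : ∀ {x} (x∈p : x ∈ p) → e zero here ≢ e (suc x) (there x∈p)
  e₀≢ x∈p eq with () ← e-inj here (there x∈p) eq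
  e′ : ∀ x → x ∈ p → Fin w
  e′ x x∈p = punchOut (e₀≢ x∈p)
  e′-inj : ∀ {x y} x∈p y∈p → e′ x x∈p ≡ e′ y y∈p → x ≡ y
  e′-inj x∈p y∈p eq = suc-injective (e-inj (there x∈p) (there y∈p) (punchOut-injective (e₀≢ x∈p) (e₀≢ y∈p) eq))

∣p∣<-injection : (p : Subset n) (e : ∀ x → x ∈ p → Fin w) →
                 (∀ {x y} x∈p y∈p → e x x∈p ≡ e y y∈p → x ≡ y) →
                 (v : Fin w) → (∀ x x∈p → e x x∈p ≢ v) → ∣ p ∣ < w
∣p∣<-injection {w = suc w} p e e-inj v v∉e = s≤s (∣p∣≤-injection p e′ e′-inj)
  where
  v≢e : ∀ {x} (x∈p : x ∈ p) → v ≢ e x x∈p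
  v≢e {x} x∈p eq = v∉e x x∈p (sym eq)
  e′ : ∀ x → x ∈ p → Fin w
  e′ x x∈p = punchOut (v≢e x∈p)
  e′-inj : ∀ {x y} x∈p y∈p → e′ x x∈p ≡ e′ y y∈p → x ≡ y
  e′-inj x∈p y∈p eq = e-inj x∈p y∈p (punchOut-injective (v≢e x∈p) (v≢e y∈p) eq)

InBlock : ℕ → ℕ → Fin n → Set
InBlock lo w v = lo ≤ toℕ v × toℕ v < lo + w

offset : ∀ {lo} {v : Fin n} → InBlock lo w v → Fin w
offset {w = w} {lo} {v} (lo≤v , v<lo+w) =
  Fin.fromℕ< (subst (toℕ v ∸ lo <_) (ℕP.m+n∸m≡n lo w) (ℕP.∸-monoˡ-< v<lo+w lo≤v))

offset-injective : ∀ {lo} {u v : Fin n} (bu : InBlock lo w u) (bv : InBlock lo w v) →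
                   offset bu ≡ offset bv → u ≡ v
offset-injective (lo≤u , _) (lo≤v , _) eq =
  toℕ-injective (ℕP.∸-cancelʳ-≡ lo≤u lo≤v (trans (sym (toℕ-fromℕ< _)) (trans (cong toℕ eq) (toℕ-fromℕ< _))))

module _ {s lo} (p : Subset s) (f : Fin s → Fin n)
         (f-inj : ∀ {x y} → x ∈ p → y ∈ p → f x ≡ f y → x ≡ y)
         (f-block : ∀ {x} → x ∈ p → InBlock lo w (f x)) where

  private
    e : ∀ x → x ∈ p → Fin w
    e x x∈p = offset (f-block x∈p)

    e-inj : ∀ {x y} x∈p y∈p → e x x∈p ≡ e y y∈p → x ≡ y
    e-inj x∈p y∈p eq = f-inj x∈p y∈p (offset-injective (f-block x∈p) (f-block y∈p) eq)

  ∣p∣≤-block : ∣ p ∣ ≤ w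
  ∣p∣≤-block = ∣p∣≤-injection p e e-inj

  ∣p∣<-block : ∀ {v} → InBlock lo w v → (∀ {x} → x ∈ p → f x ≢ v) → ∣ p ∣ < w
  ∣p∣<-block bv v∉f = ∣p∣<-injection p e e-inj (offset bv)
    (λ x x∈p eq → v∉f x∈p (offset-injective (f-block x∈p) bv eq))

-- The coefficients of f

open CommSemigroupProperties ℕP.*-commutativeSemigroup using (interchange; x∙yz≈y∙xz)

^-distribʳ-* : ∀ x y e → (x * y) ^ e ≡ x ^ e * y ^ e
^-distribʳ-* x y zero    = refl
^-distribʳ-* x y (suc e) = trans (cong (x * y *_) (^-distribʳ-* x y e)) (interchange x y (x ^ e) (y ^ e))

[1+k]*[1+n]C[1+k]≡[1+n]*nCk : ∀ n k → suc k * (suc n C suc k) ≡ suc n * (n C k)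
[1+k]*[1+n]C[1+k]≡[1+n]*nCk zero    zero    = refl
[1+k]*[1+n]C[1+k]≡[1+n]*nCk zero (suc k)
  rewrite k>n⇒nCk≡0 {1} {suc (suc k)} (s≤s (s≤s z≤n)) | k>n⇒nCk≡0 {0} {suc k} (s≤s z≤n) =
  ℕP.*-zeroʳ (suc (suc k))
[1+k]*[1+n]C[1+k]≡[1+n]*nCk (suc n) zero
  rewrite nC1≡n (suc (suc n)) = trans (ℕP.+-identityʳ (suc (suc n))) (sym (ℕP.*-identityʳ (suc (suc n))))
[1+k]*[1+n]C[1+k]≡[1+n]*nCk (suc n) (suc k) = begin
  suc (suc k) * (suc (suc n) C suc (suc k))
    ≡⟨ cong (suc (suc k) *_) (sym (nCk+nC[k+1]≡[n+1]C[k+1] (suc n) (suc k))) ⟩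
  suc (suc k) * (A + B)
    ≡⟨ ℕP.*-distribˡ-+ (suc (suc k)) A B ⟩
  (A + suc k * A) + suc (suc k) * B
    ≡⟨ cong₂ (λ u v → (A + u) + v) ([1+k]*[1+n]C[1+k]≡[1+n]*nCk n k) ([1+k]*[1+n]C[1+k]≡[1+n]*nCk n (suc k)) ⟩
  (A + suc n * (n C k)) + suc n * (n C suc k)
    ≡⟨ ℕP.+-assoc A _ _ ⟩
  A + (suc n * (n C k) + suc n * (n C suc k))
    ≡⟨ cong (A +_) (sym (ℕP.*-distribˡ-+ (suc n) (n C k) (n C suc k))) ⟩
  A + suc n * (n C k + n C suc k)
    ≡⟨ cong (λ u → A + suc n * u) (nCk+nC[k+1]≡[n+1]C[k+1] n k) ⟩
  A + suc n * A
    ∎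
  where
  open ≡-Reasoning
  A B : ℕ
  A = suc n C suc k
  B = suc n C suc (suc k)

[1+n]^k≤[1+k]^k*c : ∀ {k n} c → k ≤ n → n ^ k ≤ k ^ k * c → suc n ^ k ≤ suc k ^ k * c
[1+n]^k≤[1+k]^k*c {zero}      c _   1≤c  = 1≤c
[1+n]^k≤[1+k]^k*c {k@(suc _)} {n} c k≤n n^k≤ = ℕP.*-cancelˡ-≤ (k ^ k) {{ℕP.m^n≢0 k k}} (begin
  k ^ k * suc n ^ k            ≡⟨ sym (^-distribʳ-* k (suc n) k) ⟩
  (k * suc n) ^ k              ≤⟨ ℕP.^-monoˡ-≤ k k*[1+n]≤[1+k]*n ⟩
  (suc k * n) ^ k              ≡⟨ ^-distribʳ-* (suc k) n k ⟩
  suc k ^ k * n ^ k            ≤⟨ ℕP.*-monoʳ-≤ (suc k ^ k) n^k≤ ⟩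
  suc k ^ k * (k ^ k * c)      ≡⟨ x∙yz≈y∙xz (suc k ^ k) (k ^ k) c ⟩
  k ^ k * (suc k ^ k * c)      ∎)
  where
  open ℕP.≤-Reasoning
  k*[1+n]≤[1+k]*n : k * suc n ≤ suc k * n
  k*[1+n]≤[1+k]*n = begin
    k * suc n  ≡⟨ ℕP.*-suc k n ⟩
    k + k * n  ≤⟨ ℕP.+-monoˡ-≤ (k * n) k≤n ⟩
    n + k * n  ∎

n^k≤k^k*nCk : ∀ {k n} → k ≤ n → n ^ k ≤ k ^ k * (n C k)
n^k≤k^k*nCk {zero}            _         = ≤-refl
n^k≤k^k*nCk {suc k} {suc n} (s≤s k≤n) = begin
  suc n * suc n ^ k                        ≤⟨ ℕP.*-monoʳ-≤ (suc n) ([1+n]^k≤[1+k]^k*c (n C k) k≤n (n^k≤k^k*nCk k≤n)) ⟩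
  suc n * (suc k ^ k * (n C k))            ≡⟨ x∙yz≈y∙xz (suc n) (suc k ^ k) (n C k) ⟩
  suc k ^ k * (suc n * (n C k))            ≡⟨ cong (suc k ^ k *_) (sym ([1+k]*[1+n]C[1+k]≡[1+n]*nCk n k)) ⟩
  suc k ^ k * (suc k * (suc n C suc k))    ≡⟨ x∙yz≈y∙xz (suc k ^ k) (suc k) _ ⟩
  suc k * (suc k ^ k * (suc n C suc k))    ≡⟨ sym (ℕP.*-assoc (suc k) (suc k ^ k) _) ⟩
  suc k * suc k ^ k * (suc n C suc k)      ∎
  where open ℕP.≤-Reasoning

ℕ→ℚ≡mkℚ : ∀ a → ℕ→ℚ a ≡ mkℚ (ℤ.+ a) 0 (Coprimality.sym (Coprimality.1-coprimeTo a))
ℕ→ℚ≡mkℚ a = ℚP.normalize-coprime {a} {0} (Coprimality.sym (Coprimality.1-coprimeTo a))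

ℕ→ℚ-+ : ∀ a b → ℕ→ℚ (a + b) ≡ ℕ→ℚ a ℚ.+ ℕ→ℚ b
ℕ→ℚ-+ a b rewrite ℕ→ℚ≡mkℚ a | ℕ→ℚ≡mkℚ b =
  ℚP./-cong {p₁ = ℤ.+ (a + b)} (sym (cong₂ ℤ._+_ (ℤP.*-identityʳ (ℤ.+ a)) (ℤP.*-identityʳ (ℤ.+ b)))) refl

ℕ→ℚ-* : ∀ a b → ℕ→ℚ (a * b) ≡ ℕ→ℚ a ℚ.* ℕ→ℚ b
ℕ→ℚ-* a b rewrite ℕ→ℚ≡mkℚ a | ℕ→ℚ≡mkℚ b = ℚP./-cong {p₁ = ℤ.+ (a * b)} (ℤP.pos-* a b) refl

ℕ→ℚ-mono-≤ : ∀ {a b} → a ≤ b → ℕ→ℚ a ℚ.≤ ℕ→ℚ b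
ℕ→ℚ-mono-≤ {a} {b} a≤b rewrite ℕ→ℚ≡mkℚ a | ℕ→ℚ≡mkℚ b =
  ℚ.*≤* (subst₂ ℤ._≤_ (sym (ℤP.*-identityʳ (ℤ.+ a))) (sym (ℤP.*-identityʳ (ℤ.+ b))) (ℤ.+≤+ a≤b))

ℕ→ℚ-mono-< : ∀ {a b} → a < b → ℕ→ℚ a ℚ.< ℕ→ℚ b
ℕ→ℚ-mono-< {a} {b} a<b rewrite ℕ→ℚ≡mkℚ a | ℕ→ℚ≡mkℚ b =
  ℚ.*<* (subst₂ ℤ._<_ (sym (ℤP.*-identityʳ (ℤ.+ a))) (sym (ℤP.*-identityʳ (ℤ.+ b))) (ℤ.+<+ a<b))

ℕ→ℚ-nonNeg : ∀ a → NonNegative (ℕ→ℚ a)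
ℕ→ℚ-nonNeg a = ℚP.normalize-nonNeg a 1

frac*d≡n : ∀ n d → frac n (suc d) ℚ.* ℕ→ℚ (suc d) ≡ ℕ→ℚ n
frac*d≡n n d = ℚP.toℚᵘ-injective
  (ℚᵘP.≃-trans (ℚP.toℚᵘ-homo-* (frac n (suc d)) (ℕ→ℚ (suc d)))
  (ℚᵘP.≃-trans (ℚᵘP.*-cong (ℚP.toℚᵘ-fromℚᵘ (mkℚᵘ (ℤ.+ n) d)) (ℚP.toℚᵘ-fromℚᵘ (mkℚᵘ (ℤ.+ suc d) 0)))
  (ℚᵘP.≃-trans (ℚᵘ.*≡* cross) (ℚᵘP.≃-sym (ℚP.toℚᵘ-fromℚᵘ (mkℚᵘ (ℤ.+ n) 0))))))
  where
  cross : (ℤ.+ n ℤ.* ℤ.+ suc d) ℤ.* ℤ.+ 1 ≡ ℤ.+ n ℤ.* ℤ.+ suc (ℕ.pred (suc d * 1))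
  cross = trans (ℤP.*-identityʳ _) (cong (λ k → ℤ.+ n ℤ.* ℤ.+ k) (sym (ℕP.*-identityʳ (suc d))))

frac^e*d^e≡n^e : ∀ n d e → (frac n (suc d) ^ℚ e) ℚ.* ℕ→ℚ (suc d ^ e) ≡ ℕ→ℚ (n ^ e)
frac^e*d^e≡n^e n d zero    = ℚP.*-identityˡ 1ℚ
frac^e*d^e≡n^e n d (suc e) = begin
  (q ℚ.* (q ^ℚ e)) ℚ.* ℕ→ℚ (suc d * suc d ^ e)            ≡⟨ cong ((q ℚ.* (q ^ℚ e)) ℚ.*_) (ℕ→ℚ-* (suc d) (suc d ^ e)) ⟩
  (q ℚ.* (q ^ℚ e)) ℚ.* (ℕ→ℚ (suc d) ℚ.* ℕ→ℚ (suc d ^ e))  ≡⟨ ℚ-interchange q (q ^ℚ e) (ℕ→ℚ (suc d)) (ℕ→ℚ (suc d ^ e)) ⟩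
  (q ℚ.* ℕ→ℚ (suc d)) ℚ.* ((q ^ℚ e) ℚ.* ℕ→ℚ (suc d ^ e))  ≡⟨ cong₂ ℚ._*_ (frac*d≡n n d) (frac^e*d^e≡n^e n d e) ⟩
  ℕ→ℚ n ℚ.* ℕ→ℚ (n ^ e)                                   ≡⟨ sym (ℕ→ℚ-* n (n ^ e)) ⟩
  ℕ→ℚ (n * n ^ e)                                          ∎
  where
  open ≡-Reasoning
  open CommSemigroupProperties (CommutativeMonoid.commutativeSemigroup ℚP.*-1-commutativeMonoid)
    using () renaming (interchange to ℚ-interchange)
  q : ℚ
  q = frac n (suc d)

[n/k]^k≤nCk : ∀ {k n} → k ≤ n → frac n k ^ℚ k ℚ.≤ ℕ→ℚ (n C k)
[n/k]^k≤nCk {zero}  _   = ℚP.≤-refl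
[n/k]^k≤nCk {suc d} {n} k≤n = ℚP.*-cancelʳ-≤-pos (ℕ→ℚ (k ^ k)) {{k^k>0}} (begin
  frac n k ^ℚ k ℚ.* ℕ→ℚ (k ^ k)  ≡⟨ frac^e*d^e≡n^e n d k ⟩
  ℕ→ℚ (n ^ k)                    ≤⟨ ℕ→ℚ-mono-≤ (n^k≤k^k*nCk k≤n) ⟩
  ℕ→ℚ (k ^ k * (n C k))          ≡⟨ cong ℕ→ℚ (ℕP.*-comm (k ^ k) (n C k)) ⟩
  ℕ→ℚ ((n C k) * k ^ k)          ≡⟨ ℕ→ℚ-* (n C k) (k ^ k) ⟩
  ℕ→ℚ (n C k) ℚ.* ℕ→ℚ (k ^ k)    ∎)
  where
  open ℚP.≤-Reasoning
  k : ℕ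
  k = suc d
  k^k>0 : Positive (ℕ→ℚ (k ^ k))
  k^k>0 = ℚP.normalize-pos (k ^ k) 1 {{_}} {{ℕP.m^n≢0 k k}}

^ℚ-pos : ∀ q e → .{{Positive q}} → Positive (q ^ℚ e)
^ℚ-pos q zero    = _
^ℚ-pos q (suc e) = ℚP.pos*pos⇒pos q (q ^ℚ e) {{^ℚ-pos q e}}

-- the order along which x α + y β strictly decreases whenever 0 < β ≤ α
_≺_ : ℕ × ℕ → ℕ × ℕ → Set
(x′ , y′) ≺ (x , y) = ∃ λ d → x′ + d ≤ x × y′ ≤ y + d × (x′ + d < x ⊎ y′ < y + d)

≺-shift : ∀ {x′ y′ x₀ y₀ x y d} → x′ + d ≡ x₀ → y′ ≤ y₀ + d → x₀ ≤ x → y₀ ≤ y → x₀ < x ⊎ y₀ < y →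
          (x′ , y′) ≺ (x , y)
≺-shift {d = d} refl y′≤y₀+d x₀≤x y₀≤y x₀<x⊎y₀<y =
  d , x₀≤x , ≤-trans y′≤y₀+d (ℕP.+-monoˡ-≤ d y₀≤y) ,
  Sum.map id (λ y₀<y → ℕP.≤-<-trans y′≤y₀+d (ℕP.+-monoˡ-< d y₀<y)) x₀<x⊎y₀<y

module WeightedSum (α β : ℚ) {{β>0 : Positive β}} (β≤α : β ℚ.≤ α) where

  private instance
    α>0 : Positive α
    α>0 = ℚ.positive (ℚP.<-≤-trans (ℚP.positive⁻¹ β) β≤α)
    α≥0 : NonNegative α
    α≥0 = ℚP.pos⇒nonNeg α
    β≥0 : NonNegative β
    β≥0 = ℚP.pos⇒nonNeg β

  weighted : ℕ → ℕ → ℚ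
  weighted x y = ℕ→ℚ x ℚ.* α ℚ.+ ℕ→ℚ y ℚ.* β

  weighted-mono-≤ : ∀ {x x′ y y′} → x ≤ x′ → y ≤ y′ → weighted x y ℚ.≤ weighted x′ y′
  weighted-mono-≤ {x} {x′} {y} {y′} x≤ y≤ =
    ℚP.+-mono-≤ (ℚP.*-monoʳ-≤-nonNeg α (ℕ→ℚ-mono-≤ {x} {x′} x≤)) (ℚP.*-monoʳ-≤-nonNeg β (ℕ→ℚ-mono-≤ {y} {y′} y≤))

  weighted-monoˡ-< : ∀ {x x′} y → x < x′ → weighted x y ℚ.< weighted x′ y
  weighted-monoˡ-< {x} {x′} y x< = ℚP.+-monoˡ-< (ℕ→ℚ y ℚ.* β) (ℚP.*-monoˡ-<-pos α (ℕ→ℚ-mono-< {x} {x′} x<))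

  weighted-monoʳ-< : ∀ x {y y′} → y < y′ → weighted x y ℚ.< weighted x y′
  weighted-monoʳ-< x {y} {y′} y< = ℚP.+-monoʳ-< (ℕ→ℚ x ℚ.* α) (ℚP.*-monoˡ-<-pos β (ℕ→ℚ-mono-< {y} {y′} y<))

  weighted-shift : ∀ x y d → weighted x (y + d) ℚ.≤ weighted (x + d) y
  weighted-shift x y d = begin
    X ℚ.+ ℕ→ℚ (y + d) ℚ.* β               ≡⟨ cong (λ u → X ℚ.+ u ℚ.* β) (ℕ→ℚ-+ y d) ⟩
    X ℚ.+ (ℕ→ℚ y ℚ.+ ℕ→ℚ d) ℚ.* β         ≡⟨ cong (X ℚ.+_) (ℚP.*-distribʳ-+ β (ℕ→ℚ y) (ℕ→ℚ d)) ⟩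
    X ℚ.+ (Y ℚ.+ ℕ→ℚ d ℚ.* β)             ≤⟨ ℚP.+-monoʳ-≤ X (ℚP.+-monoʳ-≤ Y dβ≤dα) ⟩
    X ℚ.+ (Y ℚ.+ ℕ→ℚ d ℚ.* α)             ≡⟨ cong (X ℚ.+_) (ℚP.+-comm Y (ℕ→ℚ d ℚ.* α)) ⟩
    X ℚ.+ (ℕ→ℚ d ℚ.* α ℚ.+ Y)             ≡⟨ sym (ℚP.+-assoc X (ℕ→ℚ d ℚ.* α) Y) ⟩
    (X ℚ.+ ℕ→ℚ d ℚ.* α) ℚ.+ Y             ≡⟨ cong (ℚ._+ Y) (sym (ℚP.*-distribʳ-+ α (ℕ→ℚ x) (ℕ→ℚ d))) ⟩
    (ℕ→ℚ x ℚ.+ ℕ→ℚ d) ℚ.* α ℚ.+ Y         ≡⟨ cong (λ u → u ℚ.* α ℚ.+ Y) (sym (ℕ→ℚ-+ x d)) ⟩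
    ℕ→ℚ (x + d) ℚ.* α ℚ.+ Y               ∎
    where
    open ℚP.≤-Reasoning
    X Y : ℚ
    X = ℕ→ℚ x ℚ.* α
    Y = ℕ→ℚ y ℚ.* β
    dβ≤dα : ℕ→ℚ d ℚ.* β ℚ.≤ ℕ→ℚ d ℚ.* α
    dβ≤dα = ℚP.*-monoˡ-≤-nonNeg (ℕ→ℚ d) {{ℕ→ℚ-nonNeg d}} β≤α

  weighted-mono-≺ : ∀ {x′ y′ x y} → (x′ , y′) ≺ (x , y) → weighted x′ y′ ℚ.< weighted x y
  weighted-mono-≺ {x′} {y′} {x} {y} (d , x′+d≤x , y′≤y+d , inj₁ x′+d<x) = begin-strict
    weighted x′ y′        ≤⟨ weighted-mono-≤ {x′} {x′} {y′} ≤-refl y′≤y+d ⟩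
    weighted x′ (y + d)   ≤⟨ weighted-shift x′ y d ⟩
    weighted (x′ + d) y   <⟨ weighted-monoˡ-< {x′ + d} y x′+d<x ⟩
    weighted x y          ∎
    where open ℚP.≤-Reasoning
  weighted-mono-≺ {x′} {y′} {x} {y} (d , x′+d≤x , y′≤y+d , inj₂ y′<y+d) = begin-strict
    weighted x′ y′        <⟨ weighted-monoʳ-< x′ {y′} y′<y+d ⟩
    weighted x′ (y + d)   ≤⟨ weighted-shift x′ y d ⟩
    weighted (x′ + d) y   ≤⟨ weighted-mono-≤ {x′ + d} {x} {y} x′+d≤x ≤-refl ⟩
    weighted x y          ∎
    where open ℚP.≤-Reasoning

fval-diagonal : ∀ n k w x y z →
  fval n (2 + k) (2 + k) w x y z ≡ ℕ→ℚ x ℚ.* ℕ→ℚ (n C suc k) ℚ.+ ℕ→ℚ y ℚ.* (frac n (suc k) ^ℚ suc k)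
fval-diagonal n k w x y z =
  trans (cong₂ ℚ._+_ (cong (ℕ→ℚ x ℚ.* ℕ→ℚ (n C suc k) ℚ.+_) y-term) w+z-term) (ℚP.+-identityʳ _)
  where
  β : ℚ
  β = frac n (suc k) ^ℚ suc k
  y-term : ℕ→ℚ y ℚ.* ℕ→ℚ (suc k C suc k) ℚ.* β ≡ ℕ→ℚ y ℚ.* β
  y-term rewrite nCn≡1 (suc k) = cong (ℚ._* β) (ℚP.*-identityʳ (ℕ→ℚ y))
  w+z-term : (ℕ→ℚ (w + z) ℚ.- 1ℚ) ℚ.* ℕ→ℚ (k C suc k) ℚ.* (frac n k ^ℚ suc k) ≡ 0ℚ
  w+z-term rewrite k>n⇒nCk≡0 {k} {suc k} (ℕP.n<1+n k) =
    trans (cong (ℚ._* γ) (ℚP.*-zeroʳ (ℕ→ℚ (w + z) ℚ.- 1ℚ))) (ℚP.*-zeroˡ γ)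
    where
    γ : ℚ
    γ = frac n k ^ℚ suc k

fval-mono-≺ : ∀ {n k w′ x′ y′ z′ w x y z} → suc k ≤ n → (x′ , y′) ≺ (x , y) →
              fval n (2 + k) (2 + k) w′ x′ y′ z′ ℚ.< fval n (2 + k) (2 + k) w x y z
fval-mono-≺ {n@(suc _)} {k} {w′} {x′} {y′} {z′} {w} {x} {y} {z} 1+k≤n ≺xy =
  subst₂ ℚ._<_ (sym (fval-diagonal n k w′ x′ y′ z′)) (sym (fval-diagonal n k w x y z))
    (weighted-mono-≺ {x′} {y′} {x} {y} ≺xy)
  where
  instance
    β>0 : Positive (frac n (suc k) ^ℚ suc k)
    β>0 = ^ℚ-pos (frac n (suc k)) (suc k) {{ℚP.normalize-pos n (suc k)}}
  open WeightedSum (ℕ→ℚ (n C suc k)) (frac n (suc k) ^ℚ suc k) ([n/k]^k≤nCk 1+k≤n)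

AdmissibleBelow : Graph → ℕ → ℕ × ℕ → Set
AdmissibleBelow G k xy =
  Σ (Subset (m G)) λ W′ → Σ (Subset (length (edges G))) λ X′ → Σ (Subset (length (edges G))) λ Y′ →
    Admissible G k W′ X′ Y′ × (∣ X′ ∣ , ∣ Y′ ∣) ≺ xy

IsMinimiser⇒¬AdmissibleBelow : ∀ {G n k W X Y} → suc k ≤ n → IsMinimiser G n (2 + k) (2 + k) W X Y →
                               ¬ AdmissibleBelow G (2 + k) (∣ X ∣ , ∣ Y ∣)
IsMinimiser⇒¬AdmissibleBelow {G} {W = W} {X} {Y} 1+k≤n (_ , minimal) (W′ , X′ , Y′ , admissible , below) =
  ℚP.<-irrefl refl (ℚP.<-≤-trans
    (fval-mono-≺ {w′ = ∣ W′ ∣} {z′ = ∣ Zset G W′ X′ Y′ ∣} {w = ∣ W ∣} {z = ∣ Zset G W X Y ∣} 1+k≤n below)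
    (minimal W′ X′ Y′ admissible))

-- Chromatic numbers

-- Colourability is not decided here, so the step where it flips is only found under double
-- negation; this suffices, since the theorem is a negation.
¬¬-threshold : ∀ {P Q : ℕ → Set} N → (∀ j → Q j → P (suc j)) → P 0 → ¬ Q N →
               ¬ ¬ ∃ λ j → P j × ¬ Q j
¬¬-threshold zero    step p₀ ¬q k = k (0 , p₀ , ¬q)
¬¬-threshold (suc N) step p₀ ¬q k = ¬¬-excluded-middle λ
  { (no ¬q₀) → k (0 , p₀ , ¬q₀)
  ; (yes q₀) → ¬¬-threshold N (λ j → step (suc j)) (step 0 q₀) ¬q
                 (λ (j , pⱼ , ¬qⱼ) → k (suc j , pⱼ , ¬qⱼ)) }

from : ℕ → Subset n
from j = select (λ i → j ℕ.≤? toℕ i)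

∉∩from-suc : ∀ (p : Subset n) j {i} → i ∉ p ∩ from (suc j) → i ∉ p ∩ from j ⊎ toℕ i ≡ j
∉∩from-suc p j {i} i∉ with toℕ i ℕ.≟ j
... | yes i≡j = inj₂ i≡j
... | no  i≢j = inj₁ λ i∈ → let (i∈p , i∈from-j) = x∈p∩q⁻ p (from j) i∈ in
  i∉ (x∈p∩q⁺ (i∈p , ∈select⁺ (λ i → suc j ℕ.≤? toℕ i)
                      (ℕP.≤∧≢⇒< (∈select⁻ (λ i → j ℕ.≤? toℕ i) i∈from-j) (i≢j ∘ sym))))

src≢tgt : (G : Graph) (i : EIdx G) → src G i ≢ tgt G i
src≢tgt G i eq = ℕP.<-irrefl (cong toℕ eq) (All.lookup (ordered G) (∈-lookup i))

Incident? : (G : Graph) (W : Subset (m G)) → Decidable (Incident G W)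
Incident? G W i = (src G i ∈? W) ⊎-dec (tgt G i ∈? W)

module Colouring (G : Graph) where

  private
    L : ℕ
    L = length (edges G)
    variable
      W : Subset (m G)
      K K′ : EIdx G → Set
      c c′ : ℕ

  Colourable-⊆ : (∀ i → K′ i → K i) → Colourable G W K c → Colourable G W K′ c
  Colourable-⊆ K′⊆K (col , proper) = col , λ i → proper i ∘ K′⊆K i

  Colourable-≤ : c ≤ c′ → Colourable G W K c → Colourable G W K c′
  Colourable-≤ c≤c′ (col , proper) =
    (λ v v∉W → Fin.inject≤ (col v v∉W) c≤c′) ,
    λ i kᵢ pu pv eq → proper i kᵢ pu pv (inject≤-injective c≤c′ c≤c′ _ _ eq)

  Colourable-edgeless : (∀ i → ¬ K i) → Colourable G W K (suc c)
  Colourable-edgeless no-edge = (λ _ _ → zero) , λ i kᵢ → contradiction kᵢ (no-edge i)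

  χ≡2+k⇒EIdx : ∀ {k} → χ≡ G (2 + k) → EIdx G
  χ≡2+k⇒EIdx (_ , minimal) with L ℕ.≟ 0
  ... | no  L≢0 = Fin.fromℕ< (ℕP.n≢0⇒n>0 L≢0)
  ... | yes L≡0 = contradiction ((λ _ _ → zero) , λ i → contradiction (subst Fin L≡0 i) ¬Fin0)
                                (minimal 1 (s≤s (s≤s z≤n)))

  hasChromaticNumber : Colourable G W K (suc c) → ¬ Colourable G W K c → HasChromaticNumber G W K (suc c)
  hasChromaticNumber col ¬col = col , λ c′ c′<1+c col′ → ¬col (Colourable-≤ (ℕP.≤-pred c′<1+c) col′)

  HasChromaticNumber-≐ : (∀ i → K′ i → K i) → (∀ i → K i → K′ i) →
                         HasChromaticNumber G W K c → HasChromaticNumber G W K′ c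
  HasChromaticNumber-≐ K′⊆K K⊆K′ (col , minimal) =
    Colourable-⊆ K′⊆K col , λ c′ c′<c → minimal c′ c′<c ∘ Colourable-⊆ K⊆K′

  Colourable-+edge : ∀ e → (∀ i → K′ i → K i ⊎ i ≡ e) → Colourable G W K c → Colourable G W K′ (suc c)
  Colourable-+edge {K′} {K} {W} {c} e K′⊆K+e (col , proper) = col′ , proper′
    where
    col′ : (v : Fin (m G)) → v ∉ W → Fin (suc c)
    col′ v v∉W with v Fin.≟ src G e
    ... | yes _ = Fin.fromℕ c
    ... | no  _ = Fin.inject₁ (col v v∉W)
    proper′ : (i : EIdx G) → K′ i → (pu : src G i ∉ W) (pv : tgt G i ∉ W) →
              col′ (src G i) pu ≢ col′ (tgt G i) pv
    proper′ i k′ᵢ pu pv with src G i Fin.≟ src G e | tgt G i Fin.≟ src G e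
    ... | yes s≡ | yes t≡ = λ _ → src≢tgt G i (trans s≡ (sym t≡))
    ... | yes _  | no _   = fromℕ≢inject₁
    ... | no _   | yes _  = fromℕ≢inject₁ ∘ sym
    ... | no s≢  | no _   with K′⊆K+e i k′ᵢ
    ...   | inj₁ kᵢ   = proper i kᵢ pu pv ∘ inject₁-injective
    ...   | inj₂ refl = contradiction refl s≢

  Colourable-extend : IndependentSet G W → Colourable G W (λ i → ¬ Incident G W i) c →
                      Colourable G Sub.⊥ (λ _ → ⊤) (suc c)
  Colourable-extend {W} {c} independent (col , proper) = col′ , proper′
    where
    col′ : (v : Fin (m G)) → v ∉ Sub.⊥ → Fin (suc c)
    col′ v _ with v ∈? W
    ... | yes _   = Fin.fromℕ c
    ... | no v∉W = Fin.inject₁ (col v v∉W)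
    proper′ : (i : EIdx G) → ⊤ → (pu : src G i ∉ Sub.⊥) (pv : tgt G i ∉ Sub.⊥) →
              col′ (src G i) pu ≢ col′ (tgt G i) pv
    proper′ i _ _ _ with src G i ∈? W | tgt G i ∈? W
    ... | yes s∈ | yes t∈ = λ _ → independent i (s∈ , t∈)
    ... | yes _  | no _   = fromℕ≢inject₁
    ... | no _   | yes _  = fromℕ≢inject₁ ∘ sym
    ... | no s∉  | no t∉  = proper i [ s∉ , t∉ ]′ s∉ t∉ ∘ inject₁-injective

  -- The edges of p are put back one at a time, in index order; each step raises the
  -- chromatic number by at most one.
  ¬¬-removal-threshold : (Base : EIdx G → Set) (p : Subset L) →
    Colourable G W (λ i → Base i × i ∉ p) (suc c) → ¬ Colourable G W Base c →
    ¬ ¬ ∃ λ q → q ⊆ p × HasChromaticNumber G W (λ i → Base i × i ∉ q) (suc c)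
  ¬¬-removal-threshold {W} {c} Base p col ¬col =
    ¬¬-map (λ (j , colⱼ , ¬colⱼ) → p ∩ from j , (λ {x} → p∩q⊆p p (from j) {x}) , hasChromaticNumber colⱼ ¬colⱼ)
      (¬¬-threshold L step col₀ ¬col-L)
    where
    Keep : ℕ → EIdx G → Set
    Keep j i = Base i × i ∉ p ∩ from j
    step : ∀ j → Colourable G W (Keep j) c → Colourable G W (Keep (suc j)) (suc c)
    step j with j ℕ.<? L
    ... | yes j<L = Colourable-+edge (Fin.fromℕ< j<L) λ i (bᵢ , i∉) →
      Sum.map (bᵢ ,_) (λ i≡j → toℕ-injective (trans i≡j (sym (toℕ-fromℕ< j<L)))) (∉∩from-suc p j i∉)
    ... | no  j≮L = Colourable-≤ (ℕP.n≤1+n c) ∘ Colourable-⊆ λ i (bᵢ , i∉) →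
      bᵢ , [ id , (λ i≡j → contradiction (subst (ℕ._< L) i≡j (toℕ<n i)) j≮L) ]′ (∉∩from-suc p j i∉)
    col₀ : Colourable G W (Keep 0) (suc c)
    col₀ = Colourable-⊆ (λ i (bᵢ , i∉) → bᵢ , λ i∈p → i∉ (x∈p∩q⁺ (i∈p , ∈select⁺ (λ i → 0 ℕ.≤? toℕ i) z≤n)))
                        col
    ¬col-L : ¬ Colourable G W (Keep L) c
    ¬col-L = ¬col ∘ Colourable-⊆ λ i bᵢ → bᵢ , λ i∈ →
      ℕP.<⇒≱ (toℕ<n i) (∈select⁻ (λ i → L ℕ.≤? toℕ i) (proj₂ (x∈p∩q⁻ p (from L) i∈)))

-- Embeddings of G^r into G₁′

isRB? : (R : Region) → Dec (R ≡ RB)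
isRB? RA = no λ ()
isRB? RB = yes refl
isRB? RC = no λ ()
isRB? RD = no λ ()

isRD? : (R : Region) → Dec (R ≡ RD)
isRD? RA = no λ ()
isRD? RB = no λ ()
isRD? RC = no λ ()
isRD? RD = yes refl

region≡RB⇒InBlock : ∀ a b c (v : Fin n) → region a b c v ≡ RB → InBlock a b v
region≡RB⇒InBlock a b c v eq with toℕ v ℕ.<? a
... | yes _ with () ← eq
... | no v≮a with toℕ v ℕ.<? a + b
...   | yes v<a+b = ℕP.≮⇒≥ v≮a , v<a+b
...   | no _ with toℕ v ℕ.<? a + b + c
...     | yes _ with () ← eq
...     | no _  with () ← eq

region≡RC⇒InBlock : ∀ a b c (v : Fin n) → region a b c v ≡ RC → InBlock (a + b) c v
region≡RC⇒InBlock a b c v eq with toℕ v ℕ.<? a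
... | yes _ with () ← eq
... | no _ with toℕ v ℕ.<? a + b
...   | yes _ with () ← eq
...   | no v≮a+b with toℕ v ℕ.<? a + b + c
...     | yes v<a+b+c = ℕP.≮⇒≥ v≮a+b , v<a+b+c
...     | no _        with () ← eq

expEdge-injective : ∀ G r i → Injective _≡_ _≡_ (expEdge G r i)
expEdge-injective G r i {zero}          {zero}           _  = refl
expEdge-injective G r i {zero}          {suc zero}       eq = contradiction (inj₁-injective eq) (src≢tgt G i)
expEdge-injective G r i {suc zero}      {zero}           eq = contradiction (sym (inj₁-injective eq)) (src≢tgt G i)
expEdge-injective G r i {suc zero}      {suc zero}       _  = refl
expEdge-injective G r i {suc (suc j)}   {suc (suc j′)}   eq =
  cong (λ j → suc (suc j)) (,-injectiveʳ (inj₂-injective eq))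
expEdge-injective G r i {zero}          {suc (suc _)}    ()
expEdge-injective G r i {suc zero}      {suc (suc _)}    ()
expEdge-injective G r i {suc (suc _)}   {zero}           ()
expEdge-injective G r i {suc (suc _)}   {suc zero}       ()

OneInPlusPartite-image⇒≤ : ∀ {k ℓ a b c R} {part : Fin n → Fin ℓ} {g : Fin (suc k) → Fin n} →
  Injective _≡_ _≡_ g → OneInPlusPartite a b c R part (image g) → k ≤ ℓ
OneInPlusPartite-image⇒≤ {k = k} {ℓ} {part = part} {g} g-inj (u , u∈ , _ , _ , distinct)
  with ∈image⁻ g u∈
... | j₀ , refl = injective⇒≤ h-inj
  where
  h : Fin k → Fin ℓ
  h l = part (g (punchIn j₀ l))
  ≢apex : ∀ l → g (punchIn j₀ l) ≢ g j₀
  ≢apex l = punchInᵢ≢i j₀ l ∘ g-inj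
  h-inj : Injective _≡_ _≡_ h
  h-inj {l} {l′} eq with l Fin.≟ l′
  ... | yes l≡l′ = l≡l′
  ... | no  l≢l′ = contradiction eq
    (distinct _ _ (∈image⁺ g _) (∈image⁺ g _) (≢apex l) (≢apex l′) (l≢l′ ∘ punchIn-injective j₀ l l′ ∘ g-inj))

module Embedding {t n a b c : ℕ} {p₀ : Fin n → Fin (suc t)} {p₁ : Fin n → Fin (2 + t)}
  (G : Graph) (φ : ExpV G (3 + t) → Fin n) (φ-injective : Injective _≡_ _≡_ φ)
  (φ-edge : ∀ i → G₁′ n (3 + t) (3 + t) a b c p₀ p₁ (image (λ j → φ (expEdge G (3 + t) i j))))
  where

  open Colouring G

  private
    L : ℕ
    L = length (edges G)
    variable
      i : EIdx G
      v : Fin (m G)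

  edge : EIdx G → Fin (3 + t) → Fin n
  edge i j = φ (expEdge G (3 + t) i j)

  edge-injective : ∀ i → Injective _≡_ _≡_ (edge i)
  edge-injective i = expEdge-injective G (3 + t) i ∘ φ-injective

  hyperedge : EIdx G → Subset n
  hyperedge i = image (edge i)

  -- the third kind of hyperedge of G₁′ would need 2 + t vertices in distinct parts of p₀
  kind : ∀ i → OneInPlusD a b c RB (hyperedge i) ⊎ OneInPlusPartite a b c RC p₁ (hyperedge i)
  kind i with proj₂ (φ-edge i)
  ... | inj₁ B        = inj₁ B
  ... | inj₂ (inj₁ A) = contradiction (OneInPlusPartite-image⇒≤ {a = a} {b} {c} (edge-injective i) A) ℕP.1+n≰n
  ... | inj₂ (inj₂ C) = inj₂ C

  apex : EIdx G → Fin n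
  apex i = [ proj₁ , proj₁ ]′ (kind i)

  apex-∈ : ∀ i → apex i ∈ hyperedge i
  apex-∈ i with kind i
  ... | inj₁ (_ , u∈ , _) = u∈
  ... | inj₂ (_ , u∈ , _) = u∈

  apex-region : ∀ i → region a b c (apex i) ≡ RB ⊎ region a b c (apex i) ≡ RC
  apex-region i with kind i
  ... | inj₁ (_ , _ , u∈B , _) = inj₁ u∈B
  ... | inj₂ (_ , _ , u∈C , _) = inj₂ u∈C

  apex-∉D : ∀ i → region a b c (apex i) ≢ RD
  apex-∉D i with apex-region i
  ... | inj₁ u∈B = λ u∈D → case trans (sym u∈B) u∈D of λ ()
  ... | inj₂ u∈C = λ u∈D → case trans (sym u∈C) u∈D of λ ()

  ≢apex⇒D : ∀ i {w} → w ∈ hyperedge i → w ≢ apex i → region a b c w ≡ RD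
  ≢apex⇒D i with kind i
  ... | inj₁ (_ , _ , _ , rest)     = rest _
  ... | inj₂ (_ , _ , _ , rest , _) = rest _

  apex-C-partite : ∀ i → region a b c (apex i) ≢ RB → ∀ {w w′} → w ∈ hyperedge i → w′ ∈ hyperedge i →
                   w ≢ apex i → w′ ≢ apex i → w ≢ w′ → p₁ w ≢ p₁ w′
  apex-C-partite i with kind i
  ... | inj₁ (_ , _ , u∈B , _)        = λ ¬B → contradiction u∈B ¬B
  ... | inj₂ (_ , _ , _ , _ , distinct) = λ _ → distinct _ _

  InD : Fin (m G) → Set
  InD v = region a b c (φ (inj₁ v)) ≡ RD

  src∈ : ∀ i → φ (inj₁ (src G i)) ∈ hyperedge i
  src∈ i = ∈image⁺ (edge i) zero

  tgt∈ : ∀ i → φ (inj₁ (tgt G i)) ∈ hyperedge i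
  tgt∈ i = ∈image⁺ (edge i) (suc zero)

  InD⇒≢apex : ∀ i → InD v → φ (inj₁ v) ≢ apex i
  InD⇒≢apex i v∈D eq = apex-∉D i (subst (λ w → region a b c w ≡ RD) eq v∈D)

  ¬InD⇒apex : ∀ i → φ (inj₁ v) ∈ hyperedge i → ¬ InD v → φ (inj₁ v) ≡ apex i
  ¬InD⇒apex {v} i v∈ v∉D with φ (inj₁ v) Fin.≟ apex i
  ... | yes eq = eq
  ... | no  ne = contradiction (≢apex⇒D i v∈ ne) v∉D

  Internal : EIdx G → Set
  Internal i = InD (src G i) × InD (tgt G i)

  internal-apex : ∀ i → Internal i → ∃ λ j → apex i ≡ φ (inj₂ (i , j))
  internal-apex i (s∈D , t∈D) with ∈image⁻ (edge i) (apex-∈ i)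
  ... | zero          , eq = contradiction eq (InD⇒≢apex i s∈D)
  ... | suc zero      , eq = contradiction eq (InD⇒≢apex i t∈D)
  ... | suc (suc j)   , eq = j , sym eq

  internal-apex-injective : ∀ {i i′} → Internal i → Internal i′ → apex i ≡ apex i′ → i ≡ i′
  internal-apex-injective {i} {i′} int int′ eq with internal-apex i int | internal-apex i′ int′
  ... | _ , eqᵢ | _ , eqᵢ′ = ,-injectiveˡ (inj₂-injective (φ-injective (trans (sym eqᵢ) (trans eq eqᵢ′))))

  internal-apex≢vertex : Internal i → apex i ≢ φ (inj₁ v)
  internal-apex≢vertex {i} int eq with internal-apex i int
  ... | _ , eqᵢ = case φ-injective (trans (sym eqᵢ) eq) of λ ()

  Outside : Subset (m G)
  Outside = select (λ v → ¬? (isRD? (region a b c (φ (inj₁ v)))))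

  ∈Outside⇒¬InD : v ∈ Outside → ¬ InD v
  ∈Outside⇒¬InD = ∈select⁻ (λ v → ¬? (isRD? (region a b c (φ (inj₁ v)))))

  ∉Outside⇒InD : v ∉ Outside → InD v
  ∉Outside⇒InD {v} v∉ with isRD? (region a b c (φ (inj₁ v)))
  ... | yes v∈D = v∈D
  ... | no  v∉D = contradiction (∈select⁺ (λ v → ¬? (isRD? (region a b c (φ (inj₁ v))))) v∉D) v∉

  ¬Incident⇒Internal : ∀ {W} → (∀ {v} → v ∉ W → InD v) → ¬ Incident G W i → Internal i
  ¬Incident⇒Internal ∉W⇒InD ¬inc = ∉W⇒InD (¬inc ∘ inj₁) , ∉W⇒InD (¬inc ∘ inj₂)

  -- both endpoints would be mapped to the apex
  Outside-independent : IndependentSet G Outside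
  Outside-independent i (s∈ , t∈) = src≢tgt G i (inj₁-injective (φ-injective
    (trans (¬InD⇒apex i (src∈ i) (∈Outside⇒¬InD s∈)) (sym (¬InD⇒apex i (tgt∈ i) (∈Outside⇒¬InD t∈))))))

  record Deletion : Set where
    field
      W            : Subset (m G)
      independent  : IndependentSet G W
      ∉W⇒InD       : ∀ {v} → v ∉ W → InD v
      spare        : Fin n
      spare-region : region a b c spare ≡ RB ⊎ region a b c spare ≡ RC
      spare-unused : ∀ i → ¬ Incident G W i → apex i ≢ spare

  deletion-touching : ∀ i₀ → Incident G Outside i₀ → Deletion
  deletion-touching i₀ touching = record
    { W            = Outside
    ; independent  = Outside-independent
    ; ∉W⇒InD       = ∉Outside⇒InD
    ; spare        = apex i₀
    ; spare-region = apex-region i₀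
    ; spare-unused = λ i ¬inc eq →
        internal-apex≢vertex (¬Incident⇒Internal ∉Outside⇒InD ¬inc) (trans eq (sym (proj₂ touching-vertex)))
    }
    where
    touching-vertex : ∃ λ v → φ (inj₁ v) ≡ apex i₀
    touching-vertex = [ (λ s∈ → src G i₀ , ¬InD⇒apex i₀ (src∈ i₀) (∈Outside⇒¬InD s∈))
                      , (λ t∈ → tgt G i₀ , ¬InD⇒apex i₀ (tgt∈ i₀) (∈Outside⇒¬InD t∈)) ]′ touching

  deletion-isolated : ∀ i₀ → (∀ i → ¬ Incident G Outside i) → Deletion
  deletion-isolated i₀ isolated = record
    { W            = W₀
    ; independent  = W₀-independent
    ; ∉W⇒InD       = ∉W₀⇒InD
    ; spare        = apex i₀
    ; spare-region = apex-region i₀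
    ; spare-unused = unused
    }
    where
    W₀ : Subset (m G)
    W₀ = Outside ∪ ⁅ src G i₀ ⁆
    ∉W₀⇒InD : ∀ {v} → v ∉ W₀ → InD v
    ∉W₀⇒InD v∉ = ∉Outside⇒InD (v∉ ∘ p⊆p∪q ⁅ src G i₀ ⁆)
    ∈W₀⁻ : ∀ {v} → v ∈ W₀ → v ∈ Outside ⊎ v ≡ src G i₀
    ∈W₀⁻ = Sum.map₂ (x∈⁅y⁆⇒x≡y (src G i₀)) ∘ x∈p∪q⁻ Outside ⁅ src G i₀ ⁆
    W₀-independent : IndependentSet G W₀
    W₀-independent i (s∈ , t∈) with ∈W₀⁻ s∈ | ∈W₀⁻ t∈
    ... | inj₁ s∈O | _        = isolated i (inj₁ s∈O)
    ... | inj₂ _   | inj₁ t∈O = isolated i (inj₂ t∈O)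
    ... | inj₂ s≡  | inj₂ t≡  = src≢tgt G i (trans s≡ (sym t≡))
    unused : ∀ i → ¬ Incident G W₀ i → apex i ≢ apex i₀
    unused i ¬inc eq
      with refl ← internal-apex-injective (¬Incident⇒Internal ∉W₀⇒InD ¬inc)
                                          (¬Incident⇒Internal ∉Outside⇒InD (isolated i₀)) eq
      = ¬inc (inj₁ (q⊆p∪q Outside ⁅ src G i₀ ⁆ (x∈⁅x⁆ (src G i₀))))

  deletion : EIdx G → Deletion
  deletion i₀ with any? (Incident? G Outside)
  ... | yes (i , touching) = deletion-touching i touching
  ... | no  none           = deletion-isolated i₀ (λ i inc → none (i , inc))

  module _ (δ : Deletion) where

    open Deletion δ

    Kept : EIdx G → Set
    Kept i = ¬ Incident G W i

    inB? : (i : EIdx G) → Dec (region a b c (apex i) ≡ RB)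
    inB? i = isRB? (region a b c (apex i))

    X₀ Y₀ : Subset L
    X₀ = select (λ i → ¬? (Incident? G W i) ×-dec inB? i)
    Y₀ = select (λ i → ¬? (Incident? G W i) ×-dec ¬? (inB? i))

    ∈X₀⁻ : i ∈ X₀ → Kept i × region a b c (apex i) ≡ RB
    ∈X₀⁻ = ∈select⁻ (λ i → ¬? (Incident? G W i) ×-dec inB? i)

    ∈Y₀⁻ : i ∈ Y₀ → Kept i × region a b c (apex i) ≢ RB
    ∈Y₀⁻ = ∈select⁻ (λ i → ¬? (Incident? G W i) ×-dec ¬? (inB? i))

    Kept⇒∈X₀⊎∈Y₀ : Kept i → i ∈ X₀ ⊎ i ∈ Y₀
    Kept⇒∈X₀⊎∈Y₀ {i} kept with inB? i
    ... | yes B = inj₁ (∈select⁺ (λ i → ¬? (Incident? G W i) ×-dec inB? i) (kept , B))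
    ... | no ¬B = inj₂ (∈select⁺ (λ i → ¬? (Incident? G W i) ×-dec ¬? (inB? i)) (kept , ¬B))

    apex-injective : ∀ {i i′} → Kept i → Kept i′ → apex i ≡ apex i′ → i ≡ i′
    apex-injective kept kept′ =
      internal-apex-injective (¬Incident⇒Internal ∉W⇒InD kept) (¬Incident⇒Internal ∉W⇒InD kept′)

    ∈X₀⇒InBlock : i ∈ X₀ → InBlock a b (apex i)
    ∈X₀⇒InBlock {i} = region≡RB⇒InBlock a b c (apex i) ∘ proj₂ ∘ ∈X₀⁻

    ∈Y₀⇒InBlock : i ∈ Y₀ → InBlock (a + b) c (apex i)
    ∈Y₀⇒InBlock {i} i∈ = region≡RC⇒InBlock a b c (apex i)
      ([ (λ B → contradiction B (proj₂ (∈Y₀⁻ i∈))) , id ]′ (apex-region i))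

    X₀-apex-injective : ∀ {i i′} → i ∈ X₀ → i′ ∈ X₀ → apex i ≡ apex i′ → i ≡ i′
    X₀-apex-injective i∈ i′∈ = apex-injective (proj₁ (∈X₀⁻ i∈)) (proj₁ (∈X₀⁻ i′∈))

    Y₀-apex-injective : ∀ {i i′} → i ∈ Y₀ → i′ ∈ Y₀ → apex i ≡ apex i′ → i ≡ i′
    Y₀-apex-injective i∈ i′∈ = apex-injective (proj₁ (∈Y₀⁻ i∈)) (proj₁ (∈Y₀⁻ i′∈))

    ∣X₀∣≤b : ∣ X₀ ∣ ≤ b
    ∣X₀∣≤b = ∣p∣≤-block X₀ apex X₀-apex-injective ∈X₀⇒InBlock

    ∣Y₀∣≤c : ∣ Y₀ ∣ ≤ c
    ∣Y₀∣≤c = ∣p∣≤-block Y₀ apex Y₀-apex-injective ∈Y₀⇒InBlock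

    ∣X₀∣<b⊎∣Y₀∣<c : ∣ X₀ ∣ < b ⊎ ∣ Y₀ ∣ < c
    ∣X₀∣<b⊎∣Y₀∣<c = Sum.map
      (λ B → ∣p∣<-block X₀ apex X₀-apex-injective ∈X₀⇒InBlock (region≡RB⇒InBlock a b c spare B)
               (spare-unused _ ∘ proj₁ ∘ ∈X₀⁻))
      (λ C → ∣p∣<-block Y₀ apex Y₀-apex-injective ∈Y₀⇒InBlock (region≡RC⇒InBlock a b c spare C)
               (spare-unused _ ∘ proj₁ ∘ ∈Y₀⁻))
      spare-region

    -- the endpoints of an edge with apex in C are mapped into D, to distinct parts of p₁
    Colourable-without-X₀ : Colourable G W (KeepWX G W X₀) (2 + t)
    Colourable-without-X₀ = (λ v _ → p₁ (φ (inj₁ v))) , proper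
      where
      proper : ∀ i → KeepWX G W X₀ i → (pu : src G i ∉ W) (pv : tgt G i ∉ W) →
               p₁ (φ (inj₁ (src G i))) ≢ p₁ (φ (inj₁ (tgt G i)))
      proper i (kept , i∉X₀) _ _ =
        apex-C-partite i (λ B → i∉X₀ (∈select⁺ (λ i → ¬? (Incident? G W i) ×-dec inB? i) (kept , B)))
          (src∈ i) (tgt∈ i) (InD⇒≢apex i s∈D) (InD⇒≢apex i t∈D) (src≢tgt G i ∘ inj₁-injective ∘ φ-injective)
        where
        s∈D : InD (src G i)
        s∈D = proj₁ (¬Incident⇒Internal ∉W⇒InD kept)
        t∈D : InD (tgt G i)
        t∈D = proj₂ (¬Incident⇒Internal ∉W⇒InD kept)

    ¬Colourable-G−W : χ≡ G (3 + t) → ¬ Colourable G W Kept (suc t)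
    ¬Colourable-G−W χG col = proj₂ χG (2 + t) ≤-refl (Colourable-extend independent col)

    module _ {X′ : Subset L} (X′⊆X₀ : X′ ⊆ X₀) where

      Y₁ : Subset L
      Y₁ = Y₀ ∪ (X₀ ─ X′)

      no-edge-without-Y₁ : ∀ i → ¬ (KeepWX G W X′ i × i ∉ Y₁)
      no-edge-without-Y₁ i ((kept , i∉X′) , i∉Y₁) with Kept⇒∈X₀⊎∈Y₀ kept
      ... | inj₁ i∈X₀ = i∉Y₁ (q⊆p∪q Y₀ (X₀ ─ X′) (x∈p∧x∉q⇒x∈p─q i∈X₀ i∉X′))
      ... | inj₂ i∈Y₀ = i∉Y₁ (p⊆p∪q (X₀ ─ X′) i∈Y₀)

      admissible : ∀ {Y′} → Y′ ⊆ Y₁ → HasChromaticNumber G W (KeepWX G W X′) (2 + t) →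
                   HasChromaticNumber G W (λ i → KeepWX G W X′ i × i ∉ Y′) (suc t) →
                   Admissible G (3 + t) W X′ Y′
      admissible {Y′} Y′⊆Y₁ χ-X′ χ-Y′ =
        independent , disjoint , (λ i → proj₁ ∘ ∈X₀⁻ ∘ X′⊆X₀) , Y′-kept , χ-X′ ,
        HasChromaticNumber-≐ (λ i (kept , x , y) → (kept , x) , y) (λ i ((kept , x) , y) → kept , x , y) χ-Y′
        where
        disjoint : ∀ i → ¬ (i ∈ X′ × i ∈ Y′)
        disjoint i (i∈X′ , i∈Y′) with x∈p∪q⁻ Y₀ (X₀ ─ X′) (Y′⊆Y₁ i∈Y′)
        ... | inj₁ i∈Y₀ = proj₂ (∈Y₀⁻ i∈Y₀) (proj₂ (∈X₀⁻ (X′⊆X₀ i∈X′)))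
        ... | inj₂ i∈M  = x∈p─q⇒x∉q X₀ X′ i∈M i∈X′
        Y′-kept : ∀ i → i ∈ Y′ → Kept i
        Y′-kept i i∈Y′ with x∈p∪q⁻ Y₀ (X₀ ─ X′) (Y′⊆Y₁ i∈Y′)
        ... | inj₁ i∈Y₀ = proj₁ (∈Y₀⁻ i∈Y₀)
        ... | inj₂ i∈M  = proj₁ (∈X₀⁻ (p─q⊆p X₀ X′ i∈M))

      below : ∀ {Y′} → Y′ ⊆ Y₁ → (∣ X′ ∣ , ∣ Y′ ∣) ≺ (b , c)
      below Y′⊆Y₁ = ≺-shift (q⊆p⇒∣q∣+∣p─q∣≡∣p∣ X′⊆X₀)
        (≤-trans (p⊆q⇒∣p∣≤∣q∣ Y′⊆Y₁) (∣p∪q∣≤∣p∣+∣q∣ Y₀ (X₀ ─ X′))) ∣X₀∣≤b ∣Y₀∣≤c ∣X₀∣<b⊎∣Y₀∣<c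

    ¬¬-admissibleBelow : χ≡ G (3 + t) → ¬ ¬ AdmissibleBelow G (3 + t) (b , c)
    ¬¬-admissibleBelow χG no-admissible-below =
      ¬¬-removal-threshold Kept X₀ Colourable-without-X₀ (¬Colourable-G−W χG)
        λ (X′ , X′⊆X₀ , χ-X′) →
      ¬¬-removal-threshold (KeepWX G W X′) (Y₁ X′⊆X₀) (Colourable-edgeless (no-edge-without-Y₁ X′⊆X₀))
        (proj₂ χ-X′ t (ℕP.n≤1+n (suc t)))
        λ (Y′ , Y′⊆Y₁ , χ-Y′) →
      no-admissible-below (W , X′ , Y′ , admissible X′⊆X₀ Y′⊆Y₁ χ-X′ χ-Y′ , below X′⊆X₀ Y′⊆Y₁)

proposition4p1 : (r k n : ℕ) → 3 ≤ r → k ≡ r →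
    (G : Graph) → χ≡ G k →
    (W : Subset (m G)) (X Y : Subset (length (edges G))) →
    IsMinimiser G n r k W X Y →
    1 ≤ ∣ W ∣ + ∣ Zset G W X Y ∣ →
    ∣ W ∣ + ∣ X ∣ + ∣ Y ∣ + ∣ Zset G W X Y ∣ ≤ suc n →
    (p₀ : Fin n → Fin (k ∸ 2)) (p₁ : Fin n → Fin (k ∸ 1)) →
    ¬ ContainsExpansion
        (G₁′ n r k (∣ W ∣ + ∣ Zset G W X Y ∣ ∸ 1) (∣ X ∣) (∣ Y ∣) p₀ p₁)
        G r
proposition4p1 .(3 + t) .(3 + t) n (s≤s (s≤s (s≤s {n = t} z≤n))) refl G χG W X Y minimiser _ _ p₀ p₁
               (φ , φ-injective , φ-edge) =
  ¬¬-admissibleBelow (deletion i₀) χG (IsMinimiser⇒¬AdmissibleBelow {G} {W = W} 2+t≤n minimiser)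
  where
  open Embedding {a = ∣ W ∣ + ∣ Zset G W X Y ∣ ∸ 1} {∣ X ∣} {∣ Y ∣} G φ φ-injective φ-edge
  i₀ : EIdx G
  i₀ = Colouring.χ≡2+k⇒EIdx G χG
  2+t≤n : 2 + t ≤ n
  2+t≤n = ≤-trans (ℕP.n≤1+n _) (injective⇒≤ (edge-injective i₀))
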